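{- Let $13\le r\le 26$ and $0<\alpha\le \frac{1}{1000}$. Let $\mathcal{H}$ be a multicolored cluster graph on $m\ge 1$ vertices which is $K_3^{(2)}$-free, in which every edge list has size between $2$ and $r_0(r)$, whose underlying graph is $K_4$-free, and which contains no triangle all three of whose edges have lists of size at least four. Then $$c(\mathcal{H})\le r^{\frac14-\alpha}.$$
   Context: A multicolored cluster graph is a finite simple graph in which each edge $e$ is assigned a nonempty list $L_e\subseteq[r]$. It is $K_3^{(2)}$-free if there is no triangle and choice of one color from the list of each of its edges with exactly two distinct colors chosen (for lists of size at least 2, equivalently: the lists on the edges of each triangle are pairwise disjoint). $c(\mathcal{H})=\prod_{e\in E(\mathcal{H})}|L_e|^{1/|V(\mathcal{H})|^2}$. Here $r_0(r)=6$ if $r=13$ and $r_0(r)=\lfloor r-2\sqrt r\rfloor$ if $14\le r\le 26$. -}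

module Defs where

open import Data.Nat using (ℕ; zero; suc; _+_; _*_; _∸_; _≤_; _≤ᵇ_; _<ᵇ_)
open import Data.Bool using (if_then_else_)
open import Data.Fin using (Fin; zero; suc; toℕ)
open import Data.Fin.Subset using (Subset; _∈_; ∣_∣; Nonempty; Empty)
open import Data.Product using (_×_; ∃)
open import Data.Sum using (_⊎_)
open import Relation.Binary.PropositionalEquality using (_≡_; _≢_)
open import Relation.Nullary using (¬_)

ceilSqrt : ℕ → ℕ
ceilSqrt n = go (suc n) 0
  where
  go : ℕ → ℕ → ℕ
  go zero s = s
  go (suc f) s = if n ≤ᵇ s * s then s else go f (suc s)

-- r₀(r) = 6 if r = 13, and ⌊r - 2√r⌋ = r - ⌈√(4r)⌉ otherwise (used for 14 ≤ r ≤ 26)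
r₀ : ℕ → ℕ
r₀ 13 = 6
r₀ r  = r ∸ ceilSqrt (4 * r)

-- A multicolored cluster graph on vertex set Fin m with colours Fin r:
-- L i j is the list of the pair {i,j}; {i,j} is an edge iff L i j is nonempty.
record MCGraph (m r : ℕ) : Set where
  field
    L     : Fin m → Fin m → Subset r
    symm  : ∀ i j → L i j ≡ L j i
    loopless : ∀ i → Empty (L i i)

module _ {m r : ℕ} (H : MCGraph m r) where
  open MCGraph H

  Adj : Fin m → Fin m → Set
  Adj i j = Nonempty (L i j)

  Triangle : Fin m → Fin m → Fin m → Set
  Triangle i j k = Adj i j × Adj j k × Adj i k

  ExactlyTwo : Fin r → Fin r → Fin r → Set
  ExactlyTwo a b c = (a ≡ b × b ≢ c) ⊎ (a ≡ c × a ≢ b) ⊎ (b ≡ c × a ≢ b)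

  K32Free : Set
  K32Free = ∀ i j k → Triangle i j k → ∀ a b c → a ∈ L i j → b ∈ L j k → c ∈ L i k →
            ¬ ExactlyTwo a b c

  ListSizesBetween : ℕ → ℕ → Set
  ListSizesBetween lo hi = ∀ i j → Adj i j → lo ≤ ∣ L i j ∣ × ∣ L i j ∣ ≤ hi

  K4FreeUnderlying : Set
  K4FreeUnderlying = ∀ i j k l → ¬ (Adj i j × Adj i k × Adj i l × Adj j k × Adj j l × Adj k l)

  NoRichTriangle : Set
  NoRichTriangle = ∀ i j k → Triangle i j k →
                   ¬ (4 ≤ ∣ L i j ∣ × 4 ≤ ∣ L j k ∣ × 4 ≤ ∣ L i k ∣)

prodFin : (n : ℕ) → (Fin n → ℕ) → ℕ
prodFin zero f = 1
prodFin (suc n) f = f zero * prodFin n (λ i → f (suc i))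

-- weight of a pair: |L| on edges, 1 on non-edges (empty list)
pairWeight : ℕ → ℕ
pairWeight zero = 1
pairWeight (suc n) = suc n

edgeProd : ∀ {m r} → MCGraph m r → ℕ
edgeProd {m} H = prodFin m (λ i → prodFin m (λ j →
  if toℕ i <ᵇ toℕ j then pairWeight ∣ MCGraph.L H i j ∣ else 1))

module Submission where

-- Fix D = 250 and exponents a, b with 3 ^ D ≤ r ^ a and r₀(r) ^ D ≤ r ^ (a + b). An edge list has
-- at most 3 colours or is rich (between 4 and r₀(r) colours), so (∏ₑ |Lₑ|) ^ D ≤ r ^ (a e + b h)
-- where e counts the edges and h the rich edges. The underlying graph is K₄-free and the rich edges
-- form a triangle-free graph, so Turán's theorem (by induction through the neighbourhood of a vertex
-- of maximum degree) gives e ≤ m² / 3 and h ≤ m² / 4. Hence c(H) ≤ r ^ ((4a + 3b) / 12D), and the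
-- tabulated a, b make (4a + 3b) / 12D ≤ 1/4 − 1/1000.

open import Defs
open import Algebra.Bundles using (CommutativeMonoid)
open import Data.Bool using (Bool; true; false; _∧_; not; if_then_else_; T)
open import Data.Bool.Properties using (T-∧; ∧-commutativeMonoid)
open import Data.Empty using (⊥; ⊥-elim)
open import Data.Fin using (Fin; zero; suc; toℕ)
open import Data.Fin.Subset using (∣_∣)
open import Data.Fin.Subset.Properties using (nonempty?; Empty-unique; ∣⊥∣≡0)
open import Data.List using (_∷_; [])
open import Data.Nat
  using (ℕ; zero; suc; _+_; _*_; _∸_; _^_; _≤_; _<_; z≤n; s≤s; NonZero; >-nonZero; _<ᵇ_; _≤?_)
open import Data.Nat.Properties
open import Data.Nat.Tactic.RingSolver using (solve-∀; solve)
open import Data.Product using (∃-syntax; ∃₂; _,_; proj₁; proj₂; _×_)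
open import Data.Sum using (_⊎_; inj₁; inj₂)
open import Function using (_∘_; Equivalence)
open import Relation.Binary.PropositionalEquality
open import Relation.Nullary using (¬_; yes; no)
open import Relation.Nullary.Decidable using (Dec; ⌊_⌋; toWitness; from-yes; _×-dec_; _→-dec_)

open import Algebra.Properties.Semiring.Sum +-*-semiring
  using (sum; sum-syntax; sum-cong-≗; *-distribˡ-sum; sum-replicate-zero)
open import Algebra.Properties.CommutativeSemigroup +-commutativeSemigroup
  using () renaming (interchange to +-interchange)
open import Algebra.Properties.CommutativeSemigroup *-commutativeSemigroup
  using () renaming (interchange to *-interchange)
open import Algebra.Properties.CommutativeSemigroup
  (CommutativeMonoid.commutativeSemigroup ∧-commutativeMonoid)
  using () renaming (xy∙z≈xz∙y to ∧-swapʳ)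

sum-mono-≤ : ∀ {n} {f g : Fin n → ℕ} → (∀ i → f i ≤ g i) → sum f ≤ sum g
sum-mono-≤ {zero}  f≤g = z≤n
sum-mono-≤ {suc n} f≤g = +-mono-≤ (f≤g zero) (sum-mono-≤ (f≤g ∘ suc))

sum-+ : ∀ {n} (f g : Fin n → ℕ) → ∑[ i < n ] (f i + g i) ≡ sum f + sum g
sum-+ {zero}  f g = refl
sum-+ {suc n} f g = begin
  f zero + g zero + ∑[ i < n ] (f (suc i) + g (suc i))
    ≡⟨ cong (f zero + g zero +_) (sum-+ (f ∘ suc) (g ∘ suc)) ⟩
  f zero + g zero + (sum (f ∘ suc) + sum (g ∘ suc))
    ≡⟨ +-interchange (f zero) (g zero) (sum (f ∘ suc)) (sum (g ∘ suc)) ⟩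
  f zero + sum (f ∘ suc) + (g zero + sum (g ∘ suc)) ∎
  where open ≡-Reasoning

sum-swap : ∀ {m n} (f : Fin m → Fin n → ℕ) →
  ∑[ i < m ] ∑[ j < n ] f i j ≡ ∑[ j < n ] ∑[ i < m ] f i j
sum-swap {zero}  {n} f = sym (sum-replicate-zero n)
sum-swap {suc m} {n} f = begin
  sum (f zero) + ∑[ i < m ] ∑[ j < n ] f (suc i) j
    ≡⟨ cong (sum (f zero) +_) (sum-swap (f ∘ suc)) ⟩
  sum (f zero) + ∑[ j < n ] ∑[ i < m ] f (suc i) j
    ≡⟨ sum-+ (f zero) _ ⟨
  ∑[ j < n ] ∑[ i < suc m ] f i j ∎
  where open ≡-Reasoning

sum-ones : ∀ n → ∑[ i < n ] 1 ≡ n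
sum-ones zero    = refl
sum-ones (suc n) = cong suc (sum-ones n)

sum-linear : ∀ {n} a b (f g : Fin n → ℕ) → ∑[ i < n ] (a * f i + b * g i) ≡ a * sum f + b * sum g
sum-linear a b f g = trans (sum-+ (λ i → a * f i) (λ i → b * g i))
  (sym (cong₂ _+_ (*-distribˡ-sum a f) (*-distribˡ-sum b g)))

⟦_⟧ : Bool → ℕ
⟦ true ⟧  = 1
⟦ false ⟧ = 0

⟦⟧-split : ∀ u b → ⟦ u ⟧ ≡ ⟦ u ∧ b ⟧ + ⟦ u ∧ not b ⟧
⟦⟧-split false b     = refl
⟦⟧-split true  true  = refl
⟦⟧-split true  false = refl

⟦⟧-*-⟦∧⟧-swap : ∀ u v a → ⟦ u ⟧ * ⟦ v ∧ a ⟧ ≡ ⟦ v ⟧ * ⟦ u ∧ a ⟧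
⟦⟧-*-⟦∧⟧-swap false false a = refl
⟦⟧-*-⟦∧⟧-swap false true  a = refl
⟦⟧-*-⟦∧⟧-swap true  false a = refl
⟦⟧-*-⟦∧⟧-swap true  true  a = refl

T-∧-elim : ∀ {x y} → T (x ∧ y) → T x × T y
T-∧-elim = Equivalence.to T-∧

maximum-on : ∀ {n} (U : Fin n → Bool) (f : Fin n → ℕ) →
  (∀ x → ¬ T (U x)) ⊎ ∃[ v ] T (U v) × (∀ x → T (U x) → f x ≤ f v)
maximum-on {zero}  U f = inj₁ λ ()
maximum-on {suc n} U f with U zero in U₀ | maximum-on (U ∘ suc) (f ∘ suc)
... | false | inj₁ none = inj₁ λ { zero → subst T U₀ ; (suc x) → none x }
... | true  | inj₁ none =
  inj₂ (zero , subst T (sym U₀) _ , λ { zero _ → ≤-refl ; (suc x) t → ⊥-elim (none x t) })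
... | false | inj₂ (v , Uv , max) =
  inj₂ (suc v , Uv , λ { zero t → ⊥-elim (subst T U₀ t) ; (suc x) → max x })
... | true  | inj₂ (v , Uv , max) with f zero ≤? f (suc v)
...   | yes f₀≤ = inj₂ (suc v , Uv , λ { zero _ → f₀≤ ; (suc x) → max x })
...   | no  f₀≰ = inj₂ (zero , subst T (sym U₀) _ ,
          λ { zero _ → ≤-refl ; (suc x) t → ≤-trans (max x t) (<⇒≤ (≰⇒> f₀≰)) })

2mn≤m²+n² : ∀ m n → 2 * (m * n) ≤ m * m + n * n
2mn≤m²+n² zero    n       = z≤n
2mn≤m²+n² (suc m) zero    rewrite *-zeroʳ m = z≤n
2mn≤m²+n² (suc m) (suc n) = begin
  2 * (suc m * suc n)                   ≡⟨ solve (m ∷ n ∷ []) ⟩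
  2 * (m * n) + (2 * m + 2 * n + 2)     ≤⟨ +-monoˡ-≤ (2 * m + 2 * n + 2) (2mn≤m²+n² m n) ⟩
  m * m + n * n + (2 * m + 2 * n + 2)   ≡⟨ solve (m ∷ n ∷ []) ⟩
  suc m * suc m + suc n * suc n         ∎
  where open ≤-Reasoning

-- One induction step of Turán's theorem: e and t count (ordered) edges of the graph and of the
-- neighbourhood of a vertex of maximum degree Δ, and k the vertices outside that neighbourhood.
turán-step : ∀ s e t Δ k → e ≤ t + 2 * (Δ * k) → (1 + s) * t ≤ s * (Δ * Δ) →
  (2 + s) * e ≤ (1 + s) * ((Δ + k) * (Δ + k))
turán-step s e t Δ k e≤ t≤ = *-cancelˡ-≤ (1 + s) (begin
  (1 + s) * ((2 + s) * e)
    ≤⟨ *-monoʳ-≤ (1 + s) (*-monoʳ-≤ (2 + s) e≤) ⟩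
  (1 + s) * ((2 + s) * (t + 2 * (Δ * k)))
    ≡⟨ solve (s ∷ t ∷ Δ ∷ k ∷ []) ⟩
  (2 + s) * ((1 + s) * t) + 2 * (1 + s) * (2 + s) * (Δ * k)
    ≤⟨ +-monoˡ-≤ (2 * (1 + s) * (2 + s) * (Δ * k)) (*-monoʳ-≤ (2 + s) t≤) ⟩
  (2 + s) * (s * (Δ * Δ)) + 2 * (1 + s) * (2 + s) * (Δ * k)
    ≡⟨ solve (s ∷ Δ ∷ k ∷ []) ⟩
  s * (2 + s) * (Δ * Δ) + 2 * (1 + s) * (1 + s) * (Δ * k) + 2 * (Δ * ((1 + s) * k))
    ≤⟨ +-monoʳ-≤ (s * (2 + s) * (Δ * Δ) + 2 * (1 + s) * (1 + s) * (Δ * k))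
                 (2mn≤m²+n² Δ ((1 + s) * k)) ⟩
  s * (2 + s) * (Δ * Δ) + 2 * (1 + s) * (1 + s) * (Δ * k) + (Δ * Δ + (1 + s) * k * ((1 + s) * k))
    ≡⟨ solve (s ∷ Δ ∷ k ∷ []) ⟩
  (1 + s) * ((1 + s) * ((Δ + k) * (Δ + k))) ∎)
  where open ≤-Reasoning

module Graph {m : ℕ} (A : Fin m → Fin m → Bool) (A-sym : ∀ x y → A x y ≡ A y x) where

  VertexSet : Set
  VertexSet = Fin m → Bool

  infixl 7 _∩_ _∖_

  _∩_ : VertexSet → VertexSet → VertexSet
  (U ∩ V) x = U x ∧ V x

  _∖_ : VertexSet → VertexSet → VertexSet
  (U ∖ V) x = U x ∧ not (V x)

  size : VertexSet → ℕ
  size U = ∑[ x < m ] ⟦ U x ⟧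

  degree : VertexSet → Fin m → ℕ
  degree V x = size (V ∩ A x)

  -- ordered pairs (x , y) ∈ U × V with x adjacent to y: edges U U is twice the number of edges in U
  edges : VertexSet → VertexSet → ℕ
  edges U V = ∑[ x < m ] (⟦ U x ⟧ * degree V x)

  CliqueFree : ℕ → VertexSet → Set
  CliqueFree zero    U = ⊥
  CliqueFree (suc s) U = ∀ v → T (U v) → CliqueFree s (U ∩ A v)

  size-split : ∀ U B → size U ≡ size (U ∩ B) + size (U ∖ B)
  size-split U B = trans (sum-cong-≗ λ x → ⟦⟧-split (U x) (B x))
    (sum-+ (λ x → ⟦ U x ∧ B x ⟧) (λ x → ⟦ U x ∧ not (B x) ⟧))

  size-empty : ∀ U → (∀ x → ¬ T (U x)) → size U ≡ 0
  size-empty U empty = trans (sum-cong-≗ indicator-zero) (sum-replicate-zero m)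
    where
    indicator-zero : ∀ x → ⟦ U x ⟧ ≡ 0
    indicator-zero x with U x | empty x
    ... | false | _       = refl
    ... | true  | ¬true = ⊥-elim (¬true _)

  degree-split : ∀ V B x → degree V x ≡ degree (V ∩ B) x + degree (V ∖ B) x
  degree-split V B x = trans (size-split (V ∩ A x) B)
    (cong₂ _+_ (sum-cong-≗ λ y → cong ⟦_⟧ (∧-swapʳ (V y) (A x y) (B y)))
               (sum-cong-≗ λ y → cong ⟦_⟧ (∧-swapʳ (V y) (A x y) (not (B y)))))

  edges-splitˡ : ∀ U V B → edges U V ≡ edges (U ∩ B) V + edges (U ∖ B) V
  edges-splitˡ U V B = trans (sum-cong-≗ split)
    (sum-+ (λ x → ⟦ U x ∧ B x ⟧ * degree V x) (λ x → ⟦ U x ∧ not (B x) ⟧ * degree V x))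
    where
    split : ∀ x → ⟦ U x ⟧ * degree V x ≡ ⟦ U x ∧ B x ⟧ * degree V x + ⟦ U x ∧ not (B x) ⟧ * degree V x
    split x = trans (cong (_* degree V x) (⟦⟧-split (U x) (B x)))
                    (*-distribʳ-+ (degree V x) ⟦ U x ∧ B x ⟧ ⟦ U x ∧ not (B x) ⟧)

  edges-splitʳ : ∀ U V B → edges U V ≡ edges U (V ∩ B) + edges U (V ∖ B)
  edges-splitʳ U V B = trans (sum-cong-≗ split)
    (sum-+ (λ x → ⟦ U x ⟧ * degree (V ∩ B) x) (λ x → ⟦ U x ⟧ * degree (V ∖ B) x))
    where
    split : ∀ x → ⟦ U x ⟧ * degree V x ≡ ⟦ U x ⟧ * degree (V ∩ B) x + ⟦ U x ⟧ * degree (V ∖ B) x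
    split x = trans (cong (⟦ U x ⟧ *_) (degree-split V B x))
                    (*-distribˡ-+ ⟦ U x ⟧ (degree (V ∩ B) x) (degree (V ∖ B) x))

  edges-comm : ∀ U V → edges U V ≡ edges V U
  edges-comm U V = begin
    ∑[ x < m ] (⟦ U x ⟧ * ∑[ y < m ] ⟦ V y ∧ A x y ⟧)
      ≡⟨ sum-cong-≗ (λ x → *-distribˡ-sum ⟦ U x ⟧ λ y → ⟦ V y ∧ A x y ⟧) ⟩
    ∑[ x < m ] ∑[ y < m ] (⟦ U x ⟧ * ⟦ V y ∧ A x y ⟧)
      ≡⟨ sum-swap (λ x y → ⟦ U x ⟧ * ⟦ V y ∧ A x y ⟧) ⟩
    ∑[ y < m ] ∑[ x < m ] (⟦ U x ⟧ * ⟦ V y ∧ A x y ⟧)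
      ≡⟨ sum-cong-≗ (λ y → sum-cong-≗ λ x → trans (⟦⟧-*-⟦∧⟧-swap (U x) (V y) (A x y))
                                                  (cong (λ a → ⟦ V y ⟧ * ⟦ U x ∧ a ⟧) (A-sym x y))) ⟩
    ∑[ y < m ] ∑[ x < m ] (⟦ V y ⟧ * ⟦ U x ∧ A y x ⟧)
      ≡⟨ sum-cong-≗ (λ y → *-distribˡ-sum ⟦ V y ⟧ λ x → ⟦ U x ∧ A y x ⟧) ⟨
    ∑[ y < m ] (⟦ V y ⟧ * ∑[ x < m ] ⟦ U x ∧ A y x ⟧) ∎
    where open ≡-Reasoning

  edges-≤ : ∀ U V d → (∀ x → T (U x) → degree V x ≤ d) → edges U V ≤ d * size U
  edges-≤ U V d deg≤ =
    ≤-trans (sum-mono-≤ term-≤) (≤-reflexive (sym (*-distribˡ-sum d λ x → ⟦ U x ⟧)))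
    where
    term-≤ : ∀ x → ⟦ U x ⟧ * degree V x ≤ d * ⟦ U x ⟧
    term-≤ x with U x | deg≤ x
    ... | false | _    = z≤n
    ... | true  | Ux⇒ = subst₂ _≤_ (sym (+-identityʳ _)) (sym (*-identityʳ d)) (Ux⇒ _)

  edges-≤-neighbourhood : ∀ U v → (∀ x → T (U x) → degree U x ≤ degree U v) →
    edges U U ≤ edges (U ∩ A v) (U ∩ A v) + 2 * (degree U v * size (U ∖ A v))
  edges-≤-neighbourhood U v max = begin
    edges U U
      ≡⟨ edges-splitˡ U U (A v) ⟩
    edges N U + edges O U
      ≡⟨ cong (_+ edges O U) (edges-splitʳ N U (A v)) ⟩
    edges N N + edges N O + edges O U
      ≤⟨ +-mono-≤ (+-monoʳ-≤ (edges N N) N→O≤) O→U≤ ⟩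
    edges N N + Δ * K + Δ * K
      ≡⟨ +-assoc (edges N N) (Δ * K) (Δ * K) ⟩
    edges N N + (Δ * K + Δ * K)
      ≡⟨ cong (λ n → edges N N + (Δ * K + n)) (+-identityʳ (Δ * K)) ⟨
    edges N N + 2 * (Δ * K) ∎
    where
    open ≤-Reasoning
    N O : VertexSet
    N = U ∩ A v
    O = U ∖ A v
    Δ K : ℕ
    Δ = degree U v
    K = size O
    O→U≤ : edges O U ≤ Δ * K
    O→U≤ = edges-≤ O U Δ λ x Ox → max x (proj₁ (T-∧-elim Ox))
    N→O≤ : edges N O ≤ Δ * K
    N→O≤ = begin
      edges N O                ≡⟨ edges-comm N O ⟩
      edges O N                ≤⟨ m≤m+n (edges O N) (edges O (U ∖ A v)) ⟩
      edges O N + edges O O    ≡⟨ edges-splitʳ O U (A v) ⟨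
      edges O U                ≤⟨ O→U≤ ⟩
      Δ * K                    ∎

  turán : ∀ s U → CliqueFree (2 + s) U → (1 + s) * edges U U ≤ s * (size U * size U)
  turán zero U free = ≤-trans (≤-reflexive (*-identityˡ (edges U U)))
    (edges-≤ U U 0 λ x Ux → ≤-reflexive (size-empty (U ∩ A x) (free x Ux)))
  turán (suc s) U free with maximum-on U (degree U)
  ... | inj₁ empty = ≤-trans (*-monoʳ-≤ (2 + s) (edges-≤ U U 0 λ x Ux → ⊥-elim (empty x Ux)))
                             (≤-trans (≤-reflexive (*-zeroʳ (2 + s))) z≤n)
  ... | inj₂ (v , Uv , max) =
    subst (λ n → (2 + s) * edges U U ≤ (1 + s) * (n * n)) (sym (size-split U (A v)))
      (turán-step s (edges U U) (edges (U ∩ A v) (U ∩ A v)) (degree U v) (size (U ∖ A v))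
        (edges-≤-neighbourhood U v max) (turán s (U ∩ A v) (free v Uv)))

  everything : VertexSet
  everything _ = true

  size-everything : size everything ≡ m
  size-everything = sum-ones m

  edges-everything : edges everything everything ≡ ∑[ x < m ] ∑[ y < m ] ⟦ A x y ⟧
  edges-everything = sum-cong-≗ λ x → *-identityˡ (degree everything x)

^-distribʳ-* : ∀ x y n → (x * y) ^ n ≡ x ^ n * y ^ n
^-distribʳ-* x y zero    = refl
^-distribʳ-* x y (suc n) = begin
  x * y * (x * y) ^ n       ≡⟨ cong (x * y *_) (^-distribʳ-* x y n) ⟩
  x * y * (x ^ n * y ^ n)   ≡⟨ *-interchange x y (x ^ n) (y ^ n) ⟩
  x * x ^ n * (y * y ^ n)   ∎
  where open ≡-Reasoning

^-cancelˡ-≤ : ∀ n .{{_ : NonZero n}} {x y} → x ^ n ≤ y ^ n → x ≤ y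
^-cancelˡ-≤ n {x} {y} xⁿ≤yⁿ with x ≤? y
... | yes x≤y = x≤y
... | no  x≰y = ⊥-elim (<⇒≱ (^-monoˡ-< n (≰⇒> x≰y)) xⁿ≤yⁿ)

-- E ≤ r ^ (S / D) and S / D ≤ e / c give E ≤ r ^ (e / c), without leaving ℕ.
^-≤-rescale : ∀ E r D S c e .{{_ : NonZero D}} .{{_ : NonZero r}} →
  E ^ D ≤ r ^ S → S * c ≤ D * e → E ^ c ≤ r ^ e
^-≤-rescale E r D S c e Eᴰ≤rˢ Sc≤De = ^-cancelˡ-≤ D (begin
  (E ^ c) ^ D   ≡⟨ ^-*-assoc E c D ⟩
  E ^ (c * D)   ≡⟨ cong (E ^_) (*-comm c D) ⟩
  E ^ (D * c)   ≡⟨ ^-*-assoc E D c ⟨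
  (E ^ D) ^ c   ≤⟨ ^-monoˡ-≤ c Eᴰ≤rˢ ⟩
  (r ^ S) ^ c   ≡⟨ ^-*-assoc r S c ⟩
  r ^ (S * c)   ≤⟨ ^-monoʳ-≤ r Sc≤De ⟩
  r ^ (D * e)   ≡⟨ cong (r ^_) (*-comm D e) ⟩
  r ^ (e * D)   ≡⟨ ^-*-assoc r e D ⟨
  (r ^ e) ^ D   ∎)
  where open ≤-Reasoning

prodFin-^-≤ : ∀ {r D} n (f g : Fin n → ℕ) → (∀ i → f i ^ D ≤ r ^ g i) → prodFin n f ^ D ≤ r ^ sum g
prodFin-^-≤ {D = D} zero f g fᴰ≤ = ≤-reflexive (^-zeroˡ D)
prodFin-^-≤ {r} {D} (suc n) f g fᴰ≤ = begin
  (f zero * prodFin n (f ∘ suc)) ^ D     ≡⟨ ^-distribʳ-* (f zero) (prodFin n (f ∘ suc)) D ⟩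
  f zero ^ D * prodFin n (f ∘ suc) ^ D   ≤⟨ *-mono-≤ (fᴰ≤ zero) tail-≤ ⟩
  r ^ g zero * r ^ sum (g ∘ suc)         ≡⟨ ^-distribˡ-+-* r (g zero) (sum (g ∘ suc)) ⟨
  r ^ (g zero + sum (g ∘ suc))           ∎
  where
  open ≤-Reasoning
  tail-≤ : prodFin n (f ∘ suc) ^ D ≤ r ^ sum (g ∘ suc)
  tail-≤ = prodFin-^-≤ {r} {D} n (f ∘ suc) (g ∘ suc) (fᴰ≤ ∘ suc)

sumAboveDiagonal : ∀ n → (Fin n → Fin n → ℕ) → ℕ
sumAboveDiagonal n f = ∑[ i < n ] ∑[ j < n ] (if toℕ i <ᵇ toℕ j then f i j else 0)

<ᵇ-exclusive : ∀ x y c → (if x <ᵇ y then c else 0) + (if y <ᵇ x then c else 0) ≤ c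
<ᵇ-exclusive zero    zero    c = z≤n
<ᵇ-exclusive zero    (suc y) c = ≤-reflexive (+-identityʳ c)
<ᵇ-exclusive (suc x) zero    c = ≤-refl
<ᵇ-exclusive (suc x) (suc y) c = <ᵇ-exclusive x y c

sumAboveDiagonal-≤ : ∀ n (f : Fin n → Fin n → ℕ) → (∀ i j → f i j ≡ f j i) →
  2 * sumAboveDiagonal n f ≤ ∑[ i < n ] ∑[ j < n ] f i j
sumAboveDiagonal-≤ n f f-sym = begin
  2 * S
    ≡⟨ cong (S +_) (+-identityʳ S) ⟩
  S + S
    ≡⟨ cong (S +_) S≡below ⟩
  S + ∑[ i < n ] ∑[ j < n ] below i j
    ≡⟨ sum-+ (λ i → ∑[ j < n ] above i j) (λ i → ∑[ j < n ] below i j) ⟨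
  ∑[ i < n ] (∑[ j < n ] above i j + ∑[ j < n ] below i j)
    ≡⟨ sum-cong-≗ (λ i → sum-+ (above i) (below i)) ⟨
  ∑[ i < n ] ∑[ j < n ] (above i j + below i j)
    ≤⟨ sum-mono-≤ (λ i → sum-mono-≤ λ j → <ᵇ-exclusive (toℕ i) (toℕ j) (f i j)) ⟩
  ∑[ i < n ] ∑[ j < n ] f i j ∎
  where
  open ≤-Reasoning
  S : ℕ
  S = sumAboveDiagonal n f
  above below : Fin n → Fin n → ℕ
  above i j = if toℕ i <ᵇ toℕ j then f i j else 0
  below i j = if toℕ j <ᵇ toℕ i then f i j else 0
  S≡below : S ≡ ∑[ i < n ] ∑[ j < n ] below i j
  S≡below = trans (sum-cong-≗ λ i → sum-cong-≗ λ j → cong (if toℕ i <ᵇ toℕ j then_else 0) (f-sym i j))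
                  (sum-swap λ i j → if toℕ i <ᵇ toℕ j then f j i else 0)

pairWeight-≤ : ∀ {s c} → 0 < s → s ≤ c → pairWeight s ≤ c
pairWeight-≤ {suc _} _ s≤c = s≤c

module ClusterGraph {m r : ℕ} (H : MCGraph m r) where
  open MCGraph H

  adjacent rich : Fin m → Fin m → Bool
  adjacent i j = ⌊ nonempty? (L i j) ⌋
  rich i j = adjacent i j ∧ ⌊ 4 ≤? ∣ L i j ∣ ⌋

  adjacent-sym : ∀ i j → adjacent i j ≡ adjacent j i
  adjacent-sym i j = cong (λ p → ⌊ nonempty? p ⌋) (symm i j)

  rich-sym : ∀ i j → rich i j ≡ rich j i
  rich-sym i j = cong (λ p → ⌊ nonempty? p ⌋ ∧ ⌊ 4 ≤? ∣ p ∣ ⌋) (symm i j)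

  module Adjacency = Graph adjacent adjacent-sym
  module Richness = Graph rich rich-sym

  adjacent⇒Adj : ∀ {i j} → T (adjacent i j) → Adj H i j
  adjacent⇒Adj {i} {j} = toWitness {a? = nonempty? (L i j)}

  rich⇒Adj×4≤ : ∀ {i j} → T (rich i j) → Adj H i j × 4 ≤ ∣ L i j ∣
  rich⇒Adj×4≤ {i} {j} t =
    let (adj , four) = T-∧-elim {adjacent i j} t
    in adjacent⇒Adj adj , toWitness {a? = 4 ≤? ∣ L i j ∣} four

  K4-free : K4FreeUnderlying H → Adjacency.CliqueFree 4 Adjacency.everything
  K4-free k4 u _ v uv w uvw x uvwx =
    let (uw , vw) = T-∧-elim uvw
        (uvx , wx) = T-∧-elim uvwx
        (ux , vx) = T-∧-elim uvx
    in k4 u v w x (adjacent⇒Adj uv , adjacent⇒Adj uw , adjacent⇒Adj ux ,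
                   adjacent⇒Adj vw , adjacent⇒Adj vx , adjacent⇒Adj wx)

  rich-triangle-free : NoRichTriangle H → Richness.CliqueFree 3 Richness.everything
  rich-triangle-free noRich u _ v uv w uvw =
    let (uw , vw) = T-∧-elim uvw
        (Adj-uv , 4≤uv) = rich⇒Adj×4≤ uv
        (Adj-vw , 4≤vw) = rich⇒Adj×4≤ vw
        (Adj-uw , 4≤uw) = rich⇒Adj×4≤ uw
    in noRich u v w (Adj-uv , Adj-vw , Adj-uw) (4≤uv , 4≤vw , 4≤uw)

  exponent : ℕ → ℕ → Fin m → Fin m → ℕ
  exponent a b i j = a * ⟦ adjacent i j ⟧ + b * ⟦ rich i j ⟧

  module _ .{{_ : NonZero r}} {D a b : ℕ} (light : 3 ^ D ≤ r ^ a) (heavy : r₀ r ^ D ≤ r ^ (a + b))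
             (sizes : ListSizesBetween H 2 (r₀ r)) where

    ∣L∣>0 : ∀ {i j} → Adj H i j → 0 < ∣ L i j ∣
    ∣L∣>0 adj = ≤-trans (s≤s z≤n) (proj₁ (sizes _ _ adj))

    pairWeight-^-≤ : ∀ i j → pairWeight ∣ L i j ∣ ^ D ≤ r ^ exponent a b i j
    pairWeight-^-≤ i j with nonempty? (L i j) | 4 ≤? ∣ L i j ∣
    ... | no  empty | _ = begin
      pairWeight ∣ L i j ∣ ^ D   ≡⟨ cong (λ s → pairWeight s ^ D) ∣L∣≡0 ⟩
      1 ^ D                      ≡⟨ ^-zeroˡ D ⟩
      1                          ≤⟨ m^n>0 r (a * 0 + b * 0) ⟩
      r ^ (a * 0 + b * 0)        ∎
      where
      open ≤-Reasoning
      ∣L∣≡0 : ∣ L i j ∣ ≡ 0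
      ∣L∣≡0 = trans (cong ∣_∣ (Empty-unique empty)) (∣⊥∣≡0 r)
    ... | yes adj | no ¬4≤ =
      ≤-trans (^-monoˡ-≤ D (pairWeight-≤ (∣L∣>0 adj) (≤-pred (≰⇒> ¬4≤))))
              (subst (λ e → 3 ^ D ≤ r ^ e) (light-exponent a b) light)
      where
      light-exponent : ∀ a b → a ≡ a * 1 + b * 0
      light-exponent = solve-∀
    ... | yes adj | yes _ =
      ≤-trans (^-monoˡ-≤ D (pairWeight-≤ (∣L∣>0 adj) (proj₂ (sizes i j adj))))
              (subst (λ e → r₀ r ^ D ≤ r ^ e) (heavy-exponent a b) heavy)
      where
      heavy-exponent : ∀ a b → a + b ≡ a * 1 + b * 1
      heavy-exponent = solve-∀

    edgeProd-^-≤ : edgeProd H ^ D ≤ r ^ sumAboveDiagonal m (exponent a b)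
    edgeProd-^-≤ = prodFin-^-≤ {r} {D} m _ _ λ i → prodFin-^-≤ {r} {D} m _ _ λ j → term i j
      where
      term : ∀ i j → (if toℕ i <ᵇ toℕ j then pairWeight ∣ L i j ∣ else 1) ^ D
                     ≤ r ^ (if toℕ i <ᵇ toℕ j then exponent a b i j else 0)
      term i j with toℕ i <ᵇ toℕ j
      ... | true  = pairWeight-^-≤ i j
      ... | false = ≤-reflexive (^-zeroˡ D)

  exponent-total-≤ : ∀ a b → K4FreeUnderlying H → NoRichTriangle H →
    12 * sumAboveDiagonal m (exponent a b) ≤ (4 * a + 3 * b) * (m * m)
  exponent-total-≤ a b k4 noRich = begin
    12 * sumAboveDiagonal m (exponent a b)
      ≡⟨ *-assoc 6 2 (sumAboveDiagonal m (exponent a b)) ⟩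
    6 * (2 * sumAboveDiagonal m (exponent a b))
      ≤⟨ *-monoʳ-≤ 6 (sumAboveDiagonal-≤ m (exponent a b) exponent-sym) ⟩
    6 * ∑[ i < m ] ∑[ j < m ] exponent a b i j
      ≡⟨ cong (6 *_) exponent-sum ⟩
    6 * (a * e + b * h)
      ≡⟨ distribute a b e h ⟩
    2 * a * (3 * e) + 3 * b * (2 * h)
      ≤⟨ +-mono-≤ (*-monoʳ-≤ (2 * a) turán-K₄) (*-monoʳ-≤ (3 * b) mantel) ⟩
    2 * a * (2 * (m * m)) + 3 * b * (1 * (m * m))
      ≡⟨ collect a b (m * m) ⟩
    (4 * a + 3 * b) * (m * m) ∎
    where
    open ≤-Reasoning
    e h : ℕ
    e = ∑[ i < m ] ∑[ j < m ] ⟦ adjacent i j ⟧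
    h = ∑[ i < m ] ∑[ j < m ] ⟦ rich i j ⟧
    exponent-sym : ∀ i j → exponent a b i j ≡ exponent a b j i
    exponent-sym i j = cong₂ (λ x y → a * ⟦ x ⟧ + b * ⟦ y ⟧) (adjacent-sym i j) (rich-sym i j)
    exponent-sum : ∑[ i < m ] ∑[ j < m ] exponent a b i j ≡ a * e + b * h
    exponent-sum =
      trans (sum-cong-≗ λ i → sum-linear a b (λ j → ⟦ adjacent i j ⟧) (λ j → ⟦ rich i j ⟧))
            (sum-linear a b (λ i → ∑[ j < m ] ⟦ adjacent i j ⟧) (λ i → ∑[ j < m ] ⟦ rich i j ⟧))
    turán-K₄ : 3 * e ≤ 2 * (m * m)
    turán-K₄ = subst₂ (λ e n → 3 * e ≤ 2 * (n * n))
      Adjacency.edges-everything Adjacency.size-everything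
      (Adjacency.turán 2 Adjacency.everything (K4-free k4))
    mantel : 2 * h ≤ 1 * (m * m)
    mantel = subst₂ (λ h n → 2 * h ≤ 1 * (n * n))
      Richness.edges-everything Richness.size-everything
      (Richness.turán 1 Richness.everything (rich-triangle-free noRich))
    distribute : ∀ a b e h → 6 * (a * e + b * h) ≡ 2 * a * (3 * e) + 3 * b * (2 * h)
    distribute = solve-∀
    collect : ∀ a b n → 2 * a * (2 * n) + 3 * b * (1 * n) ≡ (4 * a + 3 * b) * n
    collect = solve-∀

-- With C = 4a + 3b: the slack hypothesis says C / 12D ≤ 1/4 − 1/1000 ≤ 1/4 − p/q.
exponent-budget : ∀ S C D M p q →
  12 * S ≤ C * M → 1000 * C + 12 * D ≤ 3000 * D → 1000 * p ≤ q → S * (4 * q) ≤ D * (M * (q ∸ 4 * p))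
exponent-budget S C D M p q 12S≤CM slack 1000p≤q = bound (q ∸ 4 * p) (m∸n+n≡m 4p≤q)
  where
  open ≤-Reasoning
  4p≤q : 4 * p ≤ q
  4p≤q = ≤-trans (*-monoˡ-≤ p (m≤m+n 4 996)) 1000p≤q
  bound : ∀ t → t + 4 * p ≡ q → S * (4 * q) ≤ D * (M * t)
  bound t t+4p≡q = *-cancelˡ-≤ 3 (begin
    3 * (S * (4 * q))      ≡⟨ solve (S ∷ q ∷ []) ⟩
    12 * S * q             ≤⟨ *-monoˡ-≤ q 12S≤CM ⟩
    C * M * q              ≡⟨ solve (C ∷ M ∷ q ∷ []) ⟩
    M * (C * q)            ≤⟨ *-monoʳ-≤ M Cq≤3Dt ⟩
    M * (3 * D * t)        ≡⟨ solve (M ∷ D ∷ t ∷ []) ⟩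
    3 * (D * (M * t))      ∎)
    where
    Cq≤3Dt : C * q ≤ 3 * D * t
    Cq≤3Dt = *-cancelˡ-≤ 1000 (+-cancelʳ-≤ (12 * D * (1000 * p)) (1000 * (C * q)) (1000 * (3 * D * t))
      (begin
      1000 * (C * q) + 12 * D * (1000 * p)     ≤⟨ +-monoʳ-≤ (1000 * (C * q)) (*-monoʳ-≤ (12 * D) 1000p≤q) ⟩
      1000 * (C * q) + 12 * D * q              ≡⟨ solve (C ∷ D ∷ q ∷ []) ⟩
      (1000 * C + 12 * D) * q                  ≤⟨ *-monoˡ-≤ q slack ⟩
      3000 * D * q                             ≡⟨ cong (3000 * D *_) t+4p≡q ⟨
      3000 * D * (t + 4 * p)                   ≡⟨ solve (D ∷ t ∷ p ∷ []) ⟩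
      1000 * (3 * D * t) + 12 * D * (1000 * p) ∎))

Budget : ℕ → ℕ → ℕ → Set
Budget r a b =
  3 ^ 250 ≤ r ^ a × r₀ r ^ 250 ≤ r ^ (a + b) × 1000 * (4 * a + 3 * b) + 12 * 250 ≤ 3000 * 250

budget? : ∀ r a b → Dec (Budget r a b)
budget? r a b = 3 ^ 250 ≤? r ^ a ×-dec r₀ r ^ 250 ≤? r ^ (a + b) ×-dec _ ≤? _

-- Indexed by r ∸ 13: a = ⌈250 log_r 3⌉ and a + b = ⌈250 log_r r₀(r)⌉.
exponents : ℕ → ℕ × ℕ
exponents 0  = 108 , 67
exponents 1  = 105 , 65
exponents 2  = 102 , 78
exponents 3  = 100 , 88
exponents 4  = 97 , 87
exponents 5  = 96 , 95
exponents 6  = 94 , 102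
exponents 7  = 92 , 109
exponents 8  = 91 , 106
exponents 9  = 89 , 112
exponents 10 = 88 , 117
exponents 11 = 87 , 121
exponents 12 = 86 , 125
exponents 13 = 85 , 123
exponents _  = 0 , 0

budget : ∀ r → 13 ≤ r → r ≤ 26 → ∃₂ (Budget r)
budget r 13≤r r≤26 = a r , b r , from-yes (allUpTo? table? 27) (s≤s r≤26) 13≤r
  where
  a b : ℕ → ℕ
  a r = proj₁ (exponents (r ∸ 13))
  b r = proj₂ (exponents (r ∸ 13))
  table? : ∀ r → Dec (13 ≤ r → Budget r (a r) (b r))
  table? r = 13 ≤? r →-dec budget? r (a r) (b r)

lemma3p3 : (r : ℕ) → 13 ≤ r → r ≤ 26 →
    (p q : ℕ) → 0 < p → 1000 * p ≤ q →
    (m : ℕ) → 1 ≤ m → (H : MCGraph m r) →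
    K32Free H → ListSizesBetween H 2 (r₀ r) → K4FreeUnderlying H → NoRichTriangle H →
    edgeProd H ^ (4 * q) ≤ r ^ (m * m * (q ∸ 4 * p))
lemma3p3 r 13≤r r≤26 p q _ 1000p≤q m _ H _ sizes k4 noRich =
  let a , b , light , heavy , slack = budget r 13≤r r≤26
      S = sumAboveDiagonal m (exponent a b)
  in ^-≤-rescale (edgeProd H) r 250 S (4 * q) (m * m * (q ∸ 4 * p))
       (edgeProd-^-≤ {D = 250} {a} {b} light heavy sizes)
       (exponent-budget S (4 * a + 3 * b) 250 (m * m) p q
          (exponent-total-≤ a b k4 noRich) slack 1000p≤q)
  where
  open ClusterGraph H
  instance
    r≢0 : NonZero r
    r≢0 = >-nonZero (≤-trans (s≤s z≤n) 13≤r)
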